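{- In base $b=2$, the only prime number which is antipalindromic is $p=2$ (whose binary expansion is $10$).
   Context: For $b\in\mathbb N$, $b\ge2$, write a natural number $m$ in base $b$ as $m=a_nb^n+\dots+a_1b+a_0$ with digits $a_i\in\{0,1,\dots,b-1\}$ and $a_n\neq 0$. The number $m$ is called antipalindromic in base $b$ if $a_j=b-1-a_{n-j}$ for all $j\in\{0,1,\dots,n\}$. -}

module Defs where

open import Data.Nat using (ℕ; zero; suc; _∸_; NonZero)
open import Data.Nat.DivMod using (_/_; _%_)
open import Data.List using (List; []; _∷_; length; lookup)
open import Data.Fin using (Fin; toℕ)
open import Data.Fin.Properties using ()
open import Relation.Binary.PropositionalEquality using (_≡_)

-- Base-b digits of m, least significant first: [a₀, a₁, …, aₙ] with aₙ ≠ 0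
-- (m = 0 gives the empty list).  The fuel argument k only ensures
-- termination; with fuel ≥ m it is irrelevant (each step divides by b ≥ 2).
digitsAux : (b : ℕ) → .{{NonZero b}} → ℕ → ℕ → List ℕ
digitsAux b zero    m = []
digitsAux b (suc k) zero = []
digitsAux b (suc k) (suc m) = (suc m % b) ∷ digitsAux b k (suc m / b)

digits : (b : ℕ) → .{{NonZero b}} → ℕ → List ℕ
digits b m = digitsAux b m m

Antipalindromic : (b : ℕ) → .{{NonZero b}} → ℕ → Set
Antipalindromic b m =
  (j : Fin (length (digits b m))) →
  ∀ (j' : Fin (length (digits b m))) →
  toℕ j' ≡ (length (digits b m) ∸ 1) ∸ toℕ j →
  lookup (digits b m) j ≡ (b ∸ 1) ∸ lookup (digits b m) j'

-- The most significant binary digit of a positive number is 1, so antipalindromicity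
-- forces the least significant digit to be 1 ∸ 1 = 0: an antipalindromic number is even.
-- An even prime is 2, and 2 = (10)₂ is indeed antipalindromic.
module Submission where

open import Defs
open import Data.Nat using (ℕ; zero; suc; _∸_; _≤_; _<_; s≤s; z≤n; NonZero)
open import Data.Nat.Properties using (≤-refl; ≤-pred; <-≤-trans; 1+m≢m∸n)
open import Data.Nat.DivMod using (_/_; _%_; m/n<m; m/n≡0⇒m<n; m<n⇒m%n≡m; m%n<n)
open import Data.Nat.Divisibility using (_∣_; m%n≡0⇒n∣m)
open import Data.Nat.Primality using (Prime; prime⇒irreducible; prime⇒nonZero)
open import Data.List using ([]; length; lookup)
open import Data.Fin using (Fin; fromℕ) renaming (zero to fzero; suc to fsuc)
open import Data.Fin.Properties using (toℕ-fromℕ)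
open import Data.Sum using (inj₁; inj₂)
open import Relation.Binary.PropositionalEquality using (_≡_; _≢_; refl; sym; trans; subst)
open import Function.Bundles using (_⇔_; mk⇔)
open import Relation.Nullary using (contradiction)

module _ (b : ℕ) .{{_ : NonZero b}} where

  digitsAux-zero : ∀ k → digitsAux b k 0 ≡ []
  digitsAux-zero zero    = refl
  digitsAux-zero (suc k) = refl

  -- The fuel bound m ≤ k ensures digitsAux is not cut off before the leading digit.
  lookup-last-digitsAux≢0 : 1 < b → ∀ k m → m ≤ k →
    lookup (digitsAux b (suc k) (suc m)) (fromℕ (length (digitsAux b k (suc m / b)))) ≢ 0
  lookup-last-digitsAux≢0 1<b k m m≤k with suc m / b in eq
  ... | zero rewrite digitsAux-zero k | m<n⇒m%n≡m (m/n≡0⇒m<n {suc m} {b} eq) = λ ()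
  ... | suc q with k | <-≤-trans (≤-pred (subst (_< suc m) eq (m/n<m (suc m) b 1<b))) m≤k
  ...   | suc k | s≤s q≤k = lookup-last-digitsAux≢0 1<b k q q≤k

  antipalindromic⇒%≢pred : 1 < b → ∀ m → Antipalindromic b (suc m) → suc m % b ≢ b ∸ 1
  antipalindromic⇒%≢pred 1<b@(s≤s (s≤s _)) m anti a₀≡b∸1 =
    1+n≢1+n∸d (lookup-last-digitsAux≢0 1<b m m ≤-refl) (trans (sym a₀≡b∸1) a₀≡b∸1∸aₙ)
    where
    last : Fin (length (digits b (suc m)))
    last = fromℕ (length (digitsAux b m (suc m / b)))
    a₀≡b∸1∸aₙ : suc m % b ≡ (b ∸ 1) ∸ lookup (digits b (suc m)) last
    a₀≡b∸1∸aₙ = anti fzero last (toℕ-fromℕ _)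
    1+n≢1+n∸d : ∀ {n d} → d ≢ 0 → suc n ≢ suc n ∸ d
    1+n≢1+n∸d {d = zero}  d≢0 = λ _ → d≢0 refl
    1+n≢1+n∸d {d = suc d} _   = 1+m≢m∸n d

%2≢1⇒2∣ : ∀ n → n % 2 ≢ 1 → 2 ∣ n
%2≢1⇒2∣ n n%2≢1 with n % 2 in eq | m%n<n n 2
... | zero        | _            = m%n≡0⇒n∣m n 2 eq
... | suc zero    | _            = contradiction refl n%2≢1
... | suc (suc _) | s≤s (s≤s ())

antipalindromic⇒even : ∀ m → Antipalindromic 2 (suc m) → 2 ∣ suc m
antipalindromic⇒even m anti = %2≢1⇒2∣ (suc m) (antipalindromic⇒%≢pred 2 (s≤s (s≤s z≤n)) m anti)

even-prime≡2 : ∀ {p} → Prime p → 2 ∣ p → p ≡ 2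
even-prime≡2 pr 2∣p with prime⇒irreducible pr 2∣p
... | inj₁ ()
... | inj₂ 2≡p = sym 2≡p

antipalindromic-2-2 : Antipalindromic 2 2
antipalindromic-2-2 fzero        fzero        ()
antipalindromic-2-2 fzero        (fsuc fzero) _ = refl
antipalindromic-2-2 (fsuc fzero) fzero        _ = refl
antipalindromic-2-2 (fsuc fzero) (fsuc fzero) ()

mainTheorem6 : (p : ℕ) → Prime p → (Antipalindromic 2 p ⇔ p ≡ 2)
mainTheorem6 zero    pr with () ← prime⇒nonZero pr
mainTheorem6 (suc m) pr =
  mk⇔ (λ anti → even-prime≡2 pr (antipalindromic⇒even m anti)) (λ { refl → antipalindromic-2-2 })
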